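{- Let $\Gamma\subseteq S_c[X]$ and $\beta\in S_c[X]$. If $\Gamma\vdash\beta$, then there exist $\alpha_1,\dots,\alpha_n\in\Gamma$ such that $\alpha_1\cdot\alpha_2\cdots\alpha_n\vdash\beta$.
   Context: A semiring is a set with operations $\circ$ (commutative monoid, identity $\theta$) and $\cdot$ (monoid, identity $1$), $\cdot$ distributing over $\circ$ on both sides, $\theta$ absorbing for $\cdot$, $1\ne\theta$. An I-C semiring is a commutative semiring in which every $s$ has $t=s^c$ with $s\cdot t=\theta$, $s\circ t=1$, $s\cdot s=s$, $s\circ s=s$. $X=\{x_1,x_2,\dots\}$ is countable and $S_c[X]$ is the free I-C semiring generated by $X$ (with $x_i^c$ the complement of $x_i$); it is the direct limit of the semirings $S_c[X_N]$, $X_N=\{x_1,\dots,x_N\}$, each being the quotient of the free commutative semiring on $x_1,\dots,x_N,x_1^c,\dots,x_N^c$ by the congruence generated by $(x_i\cdot x_i^c,\theta)$, $(x_i\circ x_i^c,1)$, $(x_i\circ x_i,x_i)$, $(x_i^c\circ x_i^c,x_i^c)$. For $\Gamma\subseteq S_c[X]$ let $\equiv_\Gamma$ be the congruence on $S_c[X]$ generated by $\{(\alpha,1):\alpha\in\Gamma\}$; write $\Gamma\vdash\beta$ ("$\beta$ is deduced by $\Gamma$") if $\beta\equiv_\Gamma 1$, and $\alpha\vdash\beta$ for $\{\alpha\}\vdash\beta$. -}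

module Defs where

open import Data.Nat using (ℕ)
open import Data.List using (List; []; _∷_)
open import Data.Product using (_×_)
open import Relation.Binary.PropositionalEquality using (_≡_)
open import Relation.Unary using (Pred)
open import Level using (0ℓ)

-- Terms of the free commutative semiring on the generators x_i, x_i^c (i : ℕ).
-- (X = {x_1, x_2, ...} is indexed by ℕ here.)
data Term : Set where
  x   : ℕ → Term
  xc  : ℕ → Term
  θ   : Term
  one : Term
  _∘_ : Term → Term → Term
  _·_ : Term → Term → Term

infixl 6 _∘_
infixl 7 _·_

-- With R empty this is the equality of S_c[X]; its quotient of Term is S_c[X].
data Cong (R : Term → Term → Set) : Term → Term → Set where
  gen      : ∀ {a b} → R a b → Cong R a b
  refl′    : ∀ {a} → Cong R a a
  sym′     : ∀ {a b} → Cong R a b → Cong R b a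
  trans′   : ∀ {a b c} → Cong R a b → Cong R b c → Cong R a c
  ∘-cong   : ∀ {a b c d} → Cong R a b → Cong R c d → Cong R (a ∘ c) (b ∘ d)
  ·-cong   : ∀ {a b c d} → Cong R a b → Cong R c d → Cong R (a · c) (b · d)
  ∘-assoc  : ∀ a b c → Cong R ((a ∘ b) ∘ c) (a ∘ (b ∘ c))
  ∘-comm   : ∀ a b → Cong R (a ∘ b) (b ∘ a)
  ∘-idˡ    : ∀ a → Cong R (θ ∘ a) a
  ·-assoc  : ∀ a b c → Cong R ((a · b) · c) (a · (b · c))
  ·-comm   : ∀ a b → Cong R (a · b) (b · a)
  ·-idˡ    : ∀ a → Cong R (one · a) a
  -- distributivity (the right one follows from commutativity) and absorption
  distribˡ : ∀ a b c → Cong R (a · (b ∘ c)) ((a · b) ∘ (a · c))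
  zeroˡ    : ∀ a → Cong R (θ · a) θ
  compl·   : ∀ i → Cong R (x i · xc i) θ
  compl∘   : ∀ i → Cong R (x i ∘ xc i) one
  idem-x   : ∀ i → Cong R (x i ∘ x i) (x i)
  idem-xc  : ∀ i → Cong R (xc i ∘ xc i) (xc i)

GenBy : Pred Term 0ℓ → Term → Term → Set
GenBy Γ a b = Γ a × (b ≡ one)

_≡[_]_ : Term → Pred Term 0ℓ → Term → Set
a ≡[ Γ ] b = Cong (GenBy Γ) a b

_⊢_ : Pred Term 0ℓ → Term → Set
Γ ⊢ β = β ≡[ Γ ] one

⟅_⟆ : Term → Pred Term 0ℓ
⟅ α ⟆ = λ t → t ≡ α

prod : List Term → Term
prod []       = one
prod (a ∷ as) = a · prod as

{-# OPTIONS --safe #-}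
-- A derivation of β ≡_Γ 1 is a finite tree, so it uses only finitely many
-- generating pairs (α , 1) with α ∈ Γ: a finite list αs ⊆ Γ already deduces β.
-- In an I-C semiring 1 is absorbing for ∘, which gives the absorption law
-- a ∘ a·b = a; hence a·b = 1 forces a = 1, so every member of αs is deduced by
-- prod αs, and the derivation from αs becomes one from prod αs.
module Submission where

open import Defs
open import Data.List using (List; []; _∷_; _++_)
open import Data.List.Relation.Unary.All using (All; []; _∷_)
open import Data.List.Relation.Unary.All.Properties using (++⁺)
open import Data.List.Relation.Unary.Any using (here; there)
open import Data.List.Membership.Propositional using (_∈_)
open import Data.List.Membership.Propositional.Properties using (∈-++⁺ˡ; ∈-++⁺ʳ)
open import Data.Product using (Σ; _×_; _,_; map₂)
open import Relation.Binary using (Setoid; _⇒_)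
open import Relation.Binary.PropositionalEquality using (refl)
open import Relation.Unary using (Pred; _⊆_)
open import Level using (0ℓ)

Cong-setoid : (Term → Term → Set) → Setoid 0ℓ 0ℓ
Cong-setoid R = record
  { Carrier       = Term
  ; _≈_           = Cong R
  ; isEquivalence = record { refl = refl′ ; sym = sym′ ; trans = trans′ }
  }

module ICLaws (R : Term → Term → Set) where
  open Setoid (Cong-setoid R) using (_≈_)
  open import Relation.Binary.Reasoning.Setoid (Cong-setoid R)

  ·-idʳ : ∀ a → a · one ≈ a
  ·-idʳ a = trans′ (·-comm a one) (·-idˡ a)

  ∘-zeroˡ : ∀ b → one ∘ b ≈ one
  ∘-absorbs-· : ∀ a b → a ∘ a · b ≈ a

  ∘-zeroˡ (x i) = begin
    one ∘ x i                ≈⟨ ∘-cong (sym′ (compl∘ i)) refl′ ⟩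
    (x i ∘ xc i) ∘ x i       ≈⟨ ∘-assoc _ _ _ ⟩
    x i ∘ (xc i ∘ x i)       ≈⟨ ∘-cong refl′ (∘-comm _ _) ⟩
    x i ∘ (x i ∘ xc i)       ≈⟨ sym′ (∘-assoc _ _ _) ⟩
    (x i ∘ x i) ∘ xc i       ≈⟨ ∘-cong (idem-x i) refl′ ⟩
    x i ∘ xc i               ≈⟨ compl∘ i ⟩
    one                      ∎
  ∘-zeroˡ (xc i) = begin
    one ∘ xc i               ≈⟨ ∘-cong (sym′ (compl∘ i)) refl′ ⟩
    (x i ∘ xc i) ∘ xc i      ≈⟨ ∘-assoc _ _ _ ⟩
    x i ∘ (xc i ∘ xc i)      ≈⟨ ∘-cong refl′ (idem-xc i) ⟩
    x i ∘ xc i               ≈⟨ compl∘ i ⟩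
    one                      ∎
  ∘-zeroˡ θ = trans′ (∘-comm one θ) (∘-idˡ one)
  -- Idempotence is an axiom only for generators, so 1 ∘ 1 ≈ 1 goes through x 0.
  ∘-zeroˡ one = begin
    one ∘ one                ≈⟨ ∘-cong (sym′ (compl∘ 0)) refl′ ⟩
    (x 0 ∘ xc 0) ∘ one       ≈⟨ ∘-assoc _ _ _ ⟩
    x 0 ∘ (xc 0 ∘ one)       ≈⟨ ∘-cong refl′ (trans′ (∘-comm _ _) (∘-zeroˡ (xc 0))) ⟩
    x 0 ∘ one                ≈⟨ ∘-comm _ _ ⟩
    one ∘ x 0                ≈⟨ ∘-zeroˡ (x 0) ⟩
    one                      ∎
  ∘-zeroˡ (a ∘ b) = begin
    one ∘ (a ∘ b)            ≈⟨ sym′ (∘-assoc _ _ _) ⟩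
    (one ∘ a) ∘ b            ≈⟨ ∘-cong (∘-zeroˡ a) refl′ ⟩
    one ∘ b                  ≈⟨ ∘-zeroˡ b ⟩
    one                      ∎
  ∘-zeroˡ (a · b) = begin
    one ∘ a · b              ≈⟨ ∘-cong (sym′ (∘-zeroˡ a)) refl′ ⟩
    (one ∘ a) ∘ a · b        ≈⟨ ∘-assoc _ _ _ ⟩
    one ∘ (a ∘ a · b)        ≈⟨ ∘-cong refl′ (∘-absorbs-· a b) ⟩
    one ∘ a                  ≈⟨ ∘-zeroˡ a ⟩
    one                      ∎

  ∘-absorbs-· a b = begin
    a ∘ a · b                ≈⟨ ∘-cong (sym′ (·-idʳ a)) refl′ ⟩
    a · one ∘ a · b          ≈⟨ sym′ (distribˡ a one b) ⟩
    a · (one ∘ b)            ≈⟨ ·-cong refl′ (∘-zeroˡ b) ⟩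
    a · one                  ≈⟨ ·-idʳ a ⟩
    a                        ∎

  p·q≈1⇒p≈1 : ∀ p q → p · q ≈ one → p ≈ one
  p·q≈1⇒p≈1 p q pq≈1 = begin
    p                        ≈⟨ sym′ (∘-absorbs-· p q) ⟩
    p ∘ p · q                ≈⟨ ∘-cong refl′ pq≈1 ⟩
    p ∘ one                  ≈⟨ ∘-comm _ _ ⟩
    one ∘ p                  ≈⟨ ∘-zeroˡ p ⟩
    one                      ∎

  p·q≈1⇒q≈1 : ∀ p q → p · q ≈ one → q ≈ one
  p·q≈1⇒q≈1 p q pq≈1 = p·q≈1⇒p≈1 q p (trans′ (·-comm q p) pq≈1)

  prod≈1⇒∈≈1 : ∀ {α αs} → α ∈ αs → prod αs ≈ one → α ≈ one
  prod≈1⇒∈≈1 {αs = a ∷ as} (here refl) h = p·q≈1⇒p≈1 a (prod as) h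
  prod≈1⇒∈≈1 {αs = a ∷ as} (there α∈as) h = prod≈1⇒∈≈1 α∈as (p·q≈1⇒q≈1 a (prod as) h)

open ICLaws using (prod≈1⇒∈≈1)

Cong-bind : ∀ {R R′ : Term → Term → Set} → R ⇒ Cong R′ → Cong R ⇒ Cong R′
Cong-bind f (gen r)          = f r
Cong-bind f refl′            = refl′
Cong-bind f (sym′ d)         = sym′ (Cong-bind f d)
Cong-bind f (trans′ d e)     = trans′ (Cong-bind f d) (Cong-bind f e)
Cong-bind f (∘-cong d e)     = ∘-cong (Cong-bind f d) (Cong-bind f e)
Cong-bind f (·-cong d e)     = ·-cong (Cong-bind f d) (Cong-bind f e)
Cong-bind f (∘-assoc a b c)  = ∘-assoc a b c
Cong-bind f (∘-comm a b)     = ∘-comm a b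
Cong-bind f (∘-idˡ a)        = ∘-idˡ a
Cong-bind f (·-assoc a b c)  = ·-assoc a b c
Cong-bind f (·-comm a b)     = ·-comm a b
Cong-bind f (·-idˡ a)        = ·-idˡ a
Cong-bind f (distribˡ a b c) = distribˡ a b c
Cong-bind f (zeroˡ a)        = zeroˡ a
Cong-bind f (compl· i)       = compl· i
Cong-bind f (compl∘ i)       = compl∘ i
Cong-bind f (idem-x i)       = idem-x i
Cong-bind f (idem-xc i)      = idem-xc i

≡[]-cut : ∀ {Γ Δ : Pred Term 0ℓ} → (∀ {α} → Γ α → Δ ⊢ α) → ∀ {a b} → a ≡[ Γ ] b → a ≡[ Δ ] b
≡[]-cut Δ⊢Γ = Cong-bind λ { (γ , refl) → Δ⊢Γ γ }

≡[]-mono : ∀ {Γ Δ : Pred Term 0ℓ} → Γ ⊆ Δ → ∀ {a b} → a ≡[ Γ ] b → a ≡[ Δ ] b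
≡[]-mono Γ⊆Δ = ≡[]-cut λ γ → gen (Γ⊆Δ γ , refl)

FinitelyDerived : Pred Term 0ℓ → Term → Term → Set
FinitelyDerived Γ a b = Σ (List Term) λ αs → All Γ αs × a ≡[ _∈ αs ] b

module _ {Γ : Pred Term 0ℓ} where
  private
    axiom : ∀ {a b} → a ≡[ _∈ [] ] b → FinitelyDerived Γ a b
    axiom d = [] , [] , d

    lift₂ : ∀ {a b c d e f} → (∀ {R} → Cong R a b → Cong R c d → Cong R e f)
          → FinitelyDerived Γ a b → FinitelyDerived Γ c d → FinitelyDerived Γ e f
    lift₂ rule (αs , αs⊆Γ , d) (βs , βs⊆Γ , e) =
      αs ++ βs , ++⁺ αs⊆Γ βs⊆Γ , rule (≡[]-mono ∈-++⁺ˡ d) (≡[]-mono (∈-++⁺ʳ αs) e)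

  finitely-derived : ∀ {a b} → a ≡[ Γ ] b → FinitelyDerived Γ a b
  finitely-derived (gen (γ , refl)) = _ ∷ [] , γ ∷ [] , gen (here refl , refl)
  finitely-derived refl′            = axiom refl′
  finitely-derived (sym′ d)         = map₂ (map₂ sym′) (finitely-derived d)
  finitely-derived (trans′ d e)     = lift₂ trans′ (finitely-derived d) (finitely-derived e)
  finitely-derived (∘-cong d e)     = lift₂ ∘-cong (finitely-derived d) (finitely-derived e)
  finitely-derived (·-cong d e)     = lift₂ ·-cong (finitely-derived d) (finitely-derived e)
  finitely-derived (∘-assoc a b c)  = axiom (∘-assoc a b c)
  finitely-derived (∘-comm a b)     = axiom (∘-comm a b)
  finitely-derived (∘-idˡ a)        = axiom (∘-idˡ a)
  finitely-derived (·-assoc a b c)  = axiom (·-assoc a b c)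
  finitely-derived (·-comm a b)     = axiom (·-comm a b)
  finitely-derived (·-idˡ a)        = axiom (·-idˡ a)
  finitely-derived (distribˡ a b c) = axiom (distribˡ a b c)
  finitely-derived (zeroˡ a)        = axiom (zeroˡ a)
  finitely-derived (compl· i)       = axiom (compl· i)
  finitely-derived (compl∘ i)       = axiom (compl∘ i)
  finitely-derived (idem-x i)       = axiom (idem-x i)
  finitely-derived (idem-xc i)      = axiom (idem-xc i)

prod⊢∈ : ∀ {α αs} → α ∈ αs → ⟅ prod αs ⟆ ⊢ α
prod⊢∈ α∈αs = prod≈1⇒∈≈1 _ α∈αs (gen (refl , refl))

proposition4p7 : (Γ : Pred Term 0ℓ) (β : Term) → Γ ⊢ β →
    Σ (List Term) (λ αs → All Γ αs × (⟅ prod αs ⟆ ⊢ β))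
proposition4p7 Γ β Γ⊢β =
  let αs , αs⊆Γ , αs⊢β = finitely-derived Γ⊢β
  in  αs , αs⊆Γ , ≡[]-cut prod⊢∈ αs⊢β
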